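{- For all integers $k \ge 2$ and $n \ge \log_2(2k-2)$, $\mathrm{HG}(W_{k,n}) = 2k-2$.
   Context: Hat-guessing game on a finite simple graph $G$ with $q$ colors: each vertex receives (adversarially) a hat color from $\{0,1,\dots,q-1\}$. Before the colors are assigned, the players agree on a deterministic strategy in which each vertex's guess of its own color is a function only of the colors of its neighbors. The players win if for every color assignment at least one vertex guesses its own color correctly. The hat-guessing number $\mathrm{HG}(G)$ is the largest $q$ for which a winning strategy exists. The windmill graph $W_{k,n}$ is the graph on $(k-1)n+1$ vertices obtained by taking $n$ copies of the complete graph $K_k$ and identifying one vertex from each copy into a single common vertex. -}

module Defs where

open import Level using (0ℓ)
open import Data.Nat using (ℕ; _<_; _∸_)
open import Data.Fin using (Fin)
open import Data.Maybe using (Maybe; just; nothing)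
open import Data.Product using (_×_; _,_; Σ; ∃)
open import Data.Unit using (⊤; tt)
open import Data.Empty using (⊥)
open import Relation.Nullary using (¬_)
open import Relation.Binary.PropositionalEquality using (_≡_; _≢_; refl; sym)

record SimpleGraph : Set₁ where
  field
    V      : Set
    Adj    : V → V → Set
    symm   : ∀ {u v} → Adj u v → Adj v u
    irrefl : ∀ {v} → ¬ Adj v v
open SimpleGraph public

Colouring : SimpleGraph → ℕ → Set
Colouring G q = V G → Fin q

record Strategy (G : SimpleGraph) (q : ℕ) : Set where
  field
    guess : V G → Colouring G q → Fin q
    local : ∀ v (c c′ : Colouring G q) →
            (∀ u → Adj G v u → c u ≡ c′ u) → guess v c ≡ guess v c′
open Strategy public

Wins : {G : SimpleGraph} {q : ℕ} → Strategy G q → Set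
Wins {G} {q} s = ∀ (c : Colouring G q) → ∃ λ v → guess s v c ≡ c v

Winning : SimpleGraph → ℕ → Set
Winning G q = Σ (Strategy G q) Wins

IsHatGuessingNumber : SimpleGraph → ℕ → Set
IsHatGuessingNumber G h = Winning G h × (∀ q → h < q → ¬ Winning G q)

-- Windmill graph W_{k,n}: the centre is 'nothing'; 'just (i , a)' is the a-th
-- non-centre vertex of the i-th copy of K_k (k-1 such vertices per copy).
-- Total (k-1)n+1 vertices.
WVertex : ℕ → ℕ → Set
WVertex k n = Maybe (Fin n × Fin (k ∸ 1))

WAdj : ∀ k n → WVertex k n → WVertex k n → Set
WAdj k n nothing  nothing  = ⊥
WAdj k n nothing  (just _) = ⊤
WAdj k n (just _) nothing  = ⊤
WAdj k n (just (i , a)) (just (j , b)) = i ≡ j × a ≢ b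

WAdj-sym : ∀ k n {u v} → WAdj k n u v → WAdj k n v u
WAdj-sym k n {nothing} {just _} p = tt
WAdj-sym k n {just _} {nothing} p = tt
WAdj-sym k n {just (i , a)} {just (j , b)} (e , ne) = sym e , λ x → ne (sym x)

WAdj-irrefl : ∀ k n {v} → ¬ WAdj k n v v
WAdj-irrefl k n {nothing} ()
WAdj-irrefl k n {just (i , a)} (_ , ne) = ne refl

windmill : ℕ → ℕ → SimpleGraph
windmill k n = record
  { V = WVertex k n
  ; Adj = WAdj k n
  ; symm = WAdj-sym k n
  ; irrefl = WAdj-irrefl k n
  }

-- Each vertex of K_m guesses correctly on exactly a 1/q fraction of the hat assignments, so
-- when q > 2m some assignment of a blade defeats all its vertices for two different centre
-- colours at once; the centre cannot see its own colour, so one of the two colours defeats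
-- it as well. Conversely, with q = 2(k-1) colours, blade i plays the sum strategy of K_{k-1}
-- inside the half of Z_q selected by the i-th binary digit of the centre's colour, so it wins
-- exactly when that digit predicts which half its hat sum lies in. If every blade loses, each
-- digit of the centre's colour is the complement of a bit the centre sees, which determines
-- the colour because q ≤ 2^n.
module Submission where

open import Defs
open import Data.Nat using (ℕ; _≤_; _∸_; _*_; _^_; zero; suc; _+_; _<_; _%_; _/_; NonZero; >-nonZero; z≤n; s≤s)
open import Data.Bool.Base using (if_then_else_)
open import Data.Empty using (⊥-elim)
open import Data.Fin.Base using (Fin; zero; suc; toℕ; inject≤; punchIn)
open import Data.Fin.Properties using (toℕ-injective; toℕ-fromℕ<; toℕ<n; punchInᵢ≢i; any?; inject≤-injective)
  renaming (_≟_ to _≟ᶠ_)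
open import Data.Maybe.Base using (just; nothing)
open import Data.Nat.DivMod using (_mod_; m%n<n; m≡m%n+[m/n]*n; m%n%n≡m%n; [m+kn]%n≡m%n; m<n⇒m%n≡m; %-distribˡ-+; m<n*o⇒m/o<n)
open import Data.Nat.Properties
open import Data.Product.Base using (∃; _,_; proj₁; proj₂)
open import Data.Unit.Base using (tt)
open import Data.Vec.Functional using (_∷_; removeAt)
open import Function.Base using (_∘_; case_of_)
open import Relation.Nullary using (¬_; yes; no; does)
open import Relation.Nullary.Decidable using (dec-true; dec-false)
open import Relation.Binary.PropositionalEquality

open import Algebra.Properties.CommutativeMonoid.Sum +-0-commutativeMonoid
  using (sum; sum-syntax; sum-cong-≗; ∑-distrib-+; ∑-comm; sum-remove; sum-replicate-zero)

sum-const : ∀ n c → ∑[ i < n ] c ≡ n * c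
sum-const zero    c = refl
sum-const (suc n) c = cong (c +_) (sum-const n c)

term≤sum : ∀ {n} (t : Fin n → ℕ) i → t i ≤ sum t
term≤sum {suc n} t i = subst (t i ≤_) (sym (sum-remove t)) (m≤m+n (t i) _)

sum-<⇒∃< : ∀ {n} (f g : Fin n → ℕ) → sum f < sum g → ∃ λ i → f i < g i
sum-<⇒∃< {suc n} f g lt with f zero <? g zero
... | yes f₀<g₀ = zero , f₀<g₀
... | no  f₀≮g₀ with sum-<⇒∃< (f ∘ suc) (g ∘ suc) tail<
  where
    tail< : sum (f ∘ suc) < sum (g ∘ suc)
    tail< = ≰⇒> λ tail≥ → <⇒≱ lt (+-mono-≤ (≮⇒≥ f₀≮g₀) tail≥)
... | i , fᵢ<gᵢ = suc i , fᵢ<gᵢ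

δ : ∀ {q} → Fin q → Fin q → ℕ
δ x y = if does (x ≟ᶠ y) then 1 else 0

δ-≡ : ∀ {q} {x y : Fin q} → x ≡ y → δ x y ≡ 1
δ-≡ {x = x} refl rewrite dec-true (x ≟ᶠ x) refl = refl

δ-≢ : ∀ {q} {x y : Fin q} → x ≢ y → δ x y ≡ 0
δ-≢ {x = x} {y} x≢y rewrite dec-false (x ≟ᶠ y) x≢y = refl

∑-δ : ∀ {q} (x : Fin q) → ∑[ y < q ] δ x y ≡ 1
∑-δ {suc q} x = begin
  sum (δ x)                             ≡⟨ sum-remove {i = x} (δ x) ⟩
  δ x x + sum (removeAt (δ x) x)        ≡⟨ cong₂ _+_ (δ-≡ {x = x} refl) (sum-cong-≗ (λ b → δ-≢ (punchInᵢ≢i x b ∘ sym))) ⟩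
  1 + ∑[ b < q ] 0                      ≡⟨ cong (1 +_) (sum-replicate-zero q) ⟩
  1                                     ∎
  where open ≡-Reasoning

Hats : ℕ → ℕ → Set
Hats m q = Fin m → Fin q

sumHats : ∀ m q → (Hats m q → ℕ) → ℕ
sumHats zero    q f = f (λ ())
sumHats (suc m) q f = ∑[ y < q ] sumHats m q (λ β → f (y ∷ β))

sumHats-cong : ∀ m q {f g : Hats m q → ℕ} → (∀ β → f β ≡ g β) → sumHats m q f ≡ sumHats m q g
sumHats-cong zero    q f≗g = f≗g _
sumHats-cong (suc m) q f≗g = sum-cong-≗ λ y → sumHats-cong m q (f≗g ∘ (y ∷_))

sumHats-distrib-+ : ∀ m q (f g : Hats m q → ℕ) →
  sumHats m q (λ β → f β + g β) ≡ sumHats m q f + sumHats m q g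
sumHats-distrib-+ zero    q f g = refl
sumHats-distrib-+ (suc m) q f g =
  trans (sum-cong-≗ λ y → sumHats-distrib-+ m q (f ∘ (y ∷_)) (g ∘ (y ∷_)))
        (∑-distrib-+ (λ y → sumHats m q (f ∘ (y ∷_))) (λ y → sumHats m q (g ∘ (y ∷_))))

sumHats-1 : ∀ m q → sumHats m q (λ _ → 1) ≡ q ^ m
sumHats-1 zero    q = refl
sumHats-1 (suc m) q = trans (sum-cong-≗ {q} λ _ → sumHats-1 m q) (sum-const q (q ^ m))

∑-sumHats-comm : ∀ {r} m q (f : Fin r → Hats m q → ℕ) →
  ∑[ s < r ] sumHats m q (f s) ≡ sumHats m q (λ β → ∑[ s < r ] f s β)
∑-sumHats-comm zero    q f = refl
∑-sumHats-comm (suc m) q f =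
  trans (∑-comm (λ s y → sumHats m q (f s ∘ (y ∷_))))
        (sum-cong-≗ λ y → ∑-sumHats-comm m q (λ s β → f s (y ∷ β)))

sumHats-<⇒∃< : ∀ m q (f g : Hats m q → ℕ) → sumHats m q f < sumHats m q g → ∃ λ β → f β < g β
sumHats-<⇒∃< zero    q f g lt = (λ ()) , lt
sumHats-<⇒∃< (suc m) q f g lt with sum-<⇒∃< _ _ lt
... | y , lt′ with sumHats-<⇒∃< m q (f ∘ (y ∷_)) (g ∘ (y ∷_)) lt′
... | β , fβ<gβ = y ∷ β , fβ<gβ

complete : ℕ → SimpleGraph
complete m = record
  { V      = Fin m
  ; Adj    = λ a b → a ≢ b
  ; symm   = λ a≢b → a≢b ∘ sym
  ; irrefl = λ a≢a → a≢a refl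
  }

correctGuesses : ∀ {m q} → Strategy (complete m) q → Hats m q → ℕ
correctGuesses {m} S β = ∑[ a < m ] δ (guess S a β) (β a)

fixHead : ∀ {m q} → Strategy (complete (suc m)) q → Fin q → Strategy (complete m) q
fixHead {m} {q} S y = record
  { guess = λ a β → guess S (suc a) (y ∷ β)
  ; local = λ a β γ agree → local S (suc a) (y ∷ β) (y ∷ γ) (agree-∷ agree)
  }
  where
    agree-∷ : ∀ {a} {β γ : Hats m q} → (∀ b → a ≢ b → β b ≡ γ b) →
              ∀ u → suc a ≢ u → (y ∷ β) u ≡ (y ∷ γ) u
    agree-∷ agree zero    _  = refl
    agree-∷ agree (suc b) ne = agree b (ne ∘ cong suc)

∑-δ-diagonal : ∀ q .{{_ : NonZero q}} (g : Fin q → Fin q) → (∀ y z → g y ≡ g z) →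
  ∑[ y < q ] δ (g y) y ≡ 1
∑-δ-diagonal (suc q) g g-const = trans (sum-cong-≗ λ y → cong (λ x → δ x y) (g-const y zero)) (∑-δ (g zero))

∑-correctHead : ∀ m q .{{_ : NonZero q}} (S : Strategy (complete (suc m)) q) →
  ∑[ y < q ] sumHats m q (λ β → δ (guess S zero (y ∷ β)) y) ≡ q ^ m
∑-correctHead m q S = begin
  ∑[ y < q ] sumHats m q (λ β → δ (guess S zero (y ∷ β)) y)  ≡⟨ ∑-sumHats-comm m q (λ y β → δ (guess S zero (y ∷ β)) y) ⟩
  sumHats m q (λ β → ∑[ y < q ] δ (guess S zero (y ∷ β)) y)  ≡⟨ sumHats-cong m q (λ β → ∑-δ-diagonal q _ (head-blind β)) ⟩
  sumHats m q (λ _ → 1)                                      ≡⟨ sumHats-1 m q ⟩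
  q ^ m                                                      ∎
  where
    open ≡-Reasoning
    head-blind : ∀ β y z → guess S zero (y ∷ β) ≡ guess S zero (z ∷ β)
    head-blind β y z = local S zero (y ∷ β) (z ∷ β) λ where
      zero    0≢0 → ⊥-elim (0≢0 refl)
      (suc b) _   → refl

-- NonZero q is needed: for m = 1 and q = 0 the right-hand side is 1 * 0 ^ 0 = 1.
∑-correctGuesses : ∀ m q .{{_ : NonZero q}} (S : Strategy (complete m) q) →
  sumHats m q (correctGuesses S) ≡ m * q ^ (m ∸ 1)
∑-correctGuesses zero    q S = refl
∑-correctGuesses (suc m) q S = begin
  ∑[ y < q ] sumHats m q (λ β → head y β + correctGuesses (fixHead S y) β)
    ≡⟨ sum-cong-≗ (λ y → sumHats-distrib-+ m q (head y) (correctGuesses (fixHead S y))) ⟩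
  ∑[ y < q ] (sumHats m q (head y) + sumHats m q (correctGuesses (fixHead S y)))
    ≡⟨ ∑-distrib-+ (λ y → sumHats m q (head y)) (λ y → sumHats m q (correctGuesses (fixHead S y))) ⟩
  ∑[ y < q ] sumHats m q (head y) + ∑[ y < q ] sumHats m q (correctGuesses (fixHead S y))
    ≡⟨ cong₂ _+_ (∑-correctHead m q S) (sum-cong-≗ λ y → ∑-correctGuesses m q (fixHead S y)) ⟩
  q ^ m + ∑[ y < q ] (m * q ^ (m ∸ 1))
    ≡⟨ cong (q ^ m +_) (trans (sum-const q _) (q*[m*q^[m∸1]]≡m*q^m m q)) ⟩
  q ^ m + m * q ^ m
    ∎
  where
    open ≡-Reasoning
    head : Fin q → Hats m q → ℕ
    head y β = δ (guess S zero (y ∷ β)) y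
    q*[m*q^[m∸1]]≡m*q^m : ∀ m q → q * (m * q ^ (m ∸ 1)) ≡ m * q ^ m
    q*[m*q^[m∸1]]≡m*q^m zero    q = *-zeroʳ q
    q*[m*q^[m∸1]]≡m*q^m (suc m) q = trans (sym (*-assoc q (suc m) _))
      (trans (cong (_* q ^ m) (*-comm q (suc m))) (*-assoc (suc m) q _))

r*[m*q^[m∸1]]<q^m : ∀ r m q → r * m < q → r * (m * q ^ (m ∸ 1)) < q ^ m
r*[m*q^[m∸1]]<q^m r zero    q _     rewrite *-zeroʳ r = s≤s z≤n
r*[m*q^[m∸1]]<q^m r (suc m) q rm<q = begin-strict
  r * (suc m * q ^ m)  ≡⟨ *-assoc r (suc m) (q ^ m) ⟨
  r * suc m * q ^ m    <⟨ *-monoˡ-< (q ^ m) {{m^n≢0 q m {{>-nonZero (≤-<-trans z≤n rm<q)}}}} rm<q ⟩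
  q * q ^ m            ∎
  where open ≤-Reasoning

fooling-assignment : ∀ {r m q} → r * m < q → (S : Fin r → Strategy (complete m) q) →
  ∃ λ β → ∀ s a → guess (S s) a β ≢ β a
fooling-assignment {r} {m} {q} rm<q S = β , λ s a hit → <⇒≱ nobody-hits (begin
  1                                     ≡⟨ δ-≡ hit ⟨
  δ (guess (S s) a β) (β a)             ≤⟨ term≤sum (λ a → δ (guess (S s) a β) (β a)) a ⟩
  correctGuesses (S s) β                ≤⟨ term≤sum (λ s → correctGuesses (S s) β) s ⟩
  ∑[ s < r ] correctGuesses (S s) β     ∎)
  where
    open ≤-Reasoning
    instance
      q≢0 : NonZero q
      q≢0 = >-nonZero (≤-<-trans z≤n rm<q)
    allHits<allAssignments : sumHats m q (λ β → ∑[ s < r ] correctGuesses (S s) β) < sumHats m q (λ _ → 1)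
    allHits<allAssignments = begin-strict
      sumHats m q (λ β → ∑[ s < r ] correctGuesses (S s) β)  ≡⟨ ∑-sumHats-comm m q (correctGuesses ∘ S) ⟨
      ∑[ s < r ] sumHats m q (correctGuesses (S s))          ≡⟨ sum-cong-≗ (λ s → ∑-correctGuesses m q (S s)) ⟩
      ∑[ s < r ] (m * q ^ (m ∸ 1))                           ≡⟨ sum-const r _ ⟩
      r * (m * q ^ (m ∸ 1))                                  <⟨ r*[m*q^[m∸1]]<q^m r m q rm<q ⟩
      q ^ m                                                  ≡⟨ sumHats-1 m q ⟨
      sumHats m q (λ _ → 1)                                  ∎
    fooled : ∃ λ β → ∑[ s < r ] correctGuesses (S s) β < 1
    fooled = sumHats-<⇒∃< m q _ _ allHits<allAssignments
    β : Hats m q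
    β = proj₁ fooled
    nobody-hits : ∑[ s < r ] correctGuesses (S s) β < 1
    nobody-hits = proj₂ fooled

windmillColouring : ∀ {m n q} → Fin q → (Fin n → Hats m q) → Colouring (windmill (suc m) n) q
windmillColouring x B nothing        = x
windmillColouring x B (just (i , a)) = B i a

module _ {m n q} (S : Strategy (windmill (suc m) n) q) where

  bladeStrategy : Fin n → Fin q → Strategy (complete m) q
  bladeStrategy i x = record
    { guess = λ a β → guess S (just (i , a)) (windmillColouring x (λ _ → β))
    ; local = λ a β γ agree → local S (just (i , a)) _ _ λ where
        nothing        _         → refl
        (just (j , b)) (_ , a≢b) → agree b a≢b
    }

  guess-blade : ∀ x B i a →
    guess S (just (i , a)) (windmillColouring x B) ≡ guess (bladeStrategy i x) a (B i)
  guess-blade x B i a = local S (just (i , a)) _ _ λ where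
    nothing         _          → refl
    (just (.i , b)) (refl , _) → refl

  guess-centre : ∀ x y B →
    guess S nothing (windmillColouring x B) ≡ guess S nothing (windmillColouring y B)
  guess-centre x y B = local S nothing _ _ λ where
    nothing  ()
    (just _) _ → refl

avoid : ∀ {q} (c : Fin 2 → Fin q) → c zero ≢ c (suc zero) → ∀ g → ∃ λ x → c x ≢ g
avoid c c₀≢c₁ g with c zero ≟ᶠ g
... | yes c₀≡g = suc zero , λ c₁≡g → c₀≢c₁ (trans c₀≡g (sym c₁≡g))
... | no  c₀≢g = zero , c₀≢g

windmill-losing : ∀ m n q → 2 ≤ q → 2 * m < q → ¬ Winning (windmill (suc m) n) q
windmill-losing m n q 2≤q 2m<q (S , wins) = case wins (windmillColouring (centre x) B) of λ where
    (nothing , hit) →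
      x-avoids-guess (trans (sym hit) (guess-centre S (centre x) (centre zero) B))
    (just (i , a) , hit) →
      proj₂ (fooled i) x a (trans (sym (guess-blade S (centre x) B i a)) hit)
  where
    centre : Fin 2 → Fin q
    centre x = inject≤ x 2≤q
    fooled : ∀ i → ∃ λ β → ∀ x a → guess (bladeStrategy S i (centre x)) a β ≢ β a
    fooled i = fooling-assignment 2m<q (bladeStrategy S i ∘ centre)
    B : Fin n → Hats m q
    B = proj₁ ∘ fooled
    centre-avoids-guess : ∃ λ x → centre x ≢ guess S nothing (windmillColouring (centre zero) B)
    centre-avoids-guess = avoid centre (λ eq → 0≢1 (inject≤-injective _ _ zero (suc zero) eq)) _
      where 0≢1 : zero {1} ≢ suc zero
            0≢1 ()
    x : Fin 2
    x = proj₁ centre-avoids-guess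
    x-avoids-guess : centre x ≢ guess S nothing (windmillColouring (centre zero) B)
    x-avoids-guess = proj₂ centre-avoids-guess

digit : ∀ {n} → ℕ → Fin n → ℕ
digit x zero    = x % 2
digit x (suc i) = digit (x / 2) i

digit<2 : ∀ {n} x (i : Fin n) → digit x i < 2
digit<2 x zero    = m%n<n x 2
digit<2 x (suc i) = digit<2 (x / 2) i

fromDigits : ∀ {n} → (Fin n → ℕ) → ℕ
fromDigits {zero}  d = 0
fromDigits {suc n} d = d zero + fromDigits (d ∘ suc) * 2

fromDigits-cong : ∀ {n} {d e : Fin n → ℕ} → (∀ i → d i ≡ e i) → fromDigits d ≡ fromDigits e
fromDigits-cong {zero}  _   = refl
fromDigits-cong {suc n} d≗e = cong₂ (λ a b → a + b * 2) (d≗e zero) (fromDigits-cong (d≗e ∘ suc))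

fromDigits-digit : ∀ n x → x < 2 ^ n → fromDigits (digit {n} x) ≡ x
fromDigits-digit zero    x x<1   = sym (n<1⇒n≡0 x<1)
fromDigits-digit (suc n) x x<2ⁿ⁺¹ = begin
  x % 2 + fromDigits (digit {n} (x / 2)) * 2  ≡⟨ cong (λ y → x % 2 + y * 2) (fromDigits-digit n (x / 2) x/2<2ⁿ) ⟩
  x % 2 + x / 2 * 2                           ≡⟨ m≡m%n+[m/n]*n x 2 ⟨
  x                                           ∎
  where
    open ≡-Reasoning
    x/2<2ⁿ : x / 2 < 2 ^ n
    x/2<2ⁿ = m<n*o⇒m/o<n (subst (x <_) (*-comm 2 (2 ^ n)) x<2ⁿ⁺¹)

complement-bit : ∀ {h d} → h < 2 → d < 2 → h ≢ d → d ≡ 1 ∸ h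
complement-bit {zero}      {zero}      _ _ h≢d = ⊥-elim (h≢d refl)
complement-bit {zero}      {suc zero}  _ _ _   = refl
complement-bit {suc zero}  {zero}      _ _ _   = refl
complement-bit {suc zero}  {suc zero}  _ _ h≢d = ⊥-elim (h≢d refl)
complement-bit {suc (suc _)} (s≤s (s≤s ()))
complement-bit {d = suc (suc _)} _ (s≤s (s≤s ()))

toℕ-mod : ∀ x Q .{{_ : NonZero Q}} → toℕ (x mod Q) ≡ x % Q
toℕ-mod x Q = toℕ-fromℕ< (m%n<n x Q)

%-cancel-complement : ∀ Q .{{_ : NonZero Q}} {x} r → x < Q → ((x + r) % Q + (Q ∸ r % Q)) % Q ≡ x
%-cancel-complement Q {x} r x<Q = begin
  ((x + r) % Q + (Q ∸ r % Q)) % Q               ≡⟨ %-distribˡ-+ ((x + r) % Q) (Q ∸ r % Q) Q ⟩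
  ((x + r) % Q % Q + (Q ∸ r % Q) % Q) % Q       ≡⟨ cong (λ z → (z + (Q ∸ r % Q) % Q) % Q) (m%n%n≡m%n (x + r) Q) ⟩
  ((x + r) % Q + (Q ∸ r % Q) % Q) % Q           ≡⟨ %-distribˡ-+ (x + r) (Q ∸ r % Q) Q ⟨
  (x + r + (Q ∸ r % Q)) % Q                     ≡⟨ cong (λ z → (x + z + (Q ∸ r % Q)) % Q) (m≡m%n+[m/n]*n r Q) ⟩
  (x + (r % Q + r / Q * Q) + (Q ∸ r % Q)) % Q   ≡⟨ cong (_% Q) (regroup x (r % Q) (r / Q * Q) (Q ∸ r % Q)) ⟩
  (x + (r / Q * Q + (r % Q + (Q ∸ r % Q)))) % Q ≡⟨ cong (λ z → (x + (r / Q * Q + z)) % Q) (m+[n∸m]≡n (<⇒≤ (m%n<n r Q))) ⟩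
  (x + (r / Q * Q + Q)) % Q                     ≡⟨ cong (λ z → (x + z) % Q) (+-comm (r / Q * Q) Q) ⟩
  (x + suc (r / Q) * Q) % Q                     ≡⟨ [m+kn]%n≡m%n x (suc (r / Q)) Q ⟩
  x % Q                                         ≡⟨ m<n⇒m%n≡m x<Q ⟩
  x                                             ∎
  where
    open ≡-Reasoning
    regroup : ∀ a b c d → a + (b + c) + d ≡ a + (c + (b + d))
    regroup a b c d = trans (+-assoc a (b + c) d)
      (cong (a +_) (trans (cong (_+ d) (+-comm b c)) (+-assoc c b d)))

module WindmillStrategy (m n : ℕ) (2[1+m]≤2ⁿ : 2 * suc m ≤ 2 ^ n) where

  M Q : ℕ
  M = suc m
  Q = 2 * M

  W : SimpleGraph
  W = windmill (suc M) n

  bladeHats : Colouring W Q → Fin n → Fin M → ℕ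
  bladeHats c i b = toℕ (c (just (i , b)))

  half : Colouring W Q → Fin n → ℕ
  half c i = sum (bladeHats c i) % Q / M

  target : Colouring W Q → Fin n → Fin M → ℕ
  target c i a = toℕ a + digit (toℕ (c nothing)) i * M

  windmillGuess : V W → Colouring W Q → Fin Q
  windmillGuess nothing        c = fromDigits (λ i → 1 ∸ half c i) mod Q
  windmillGuess (just (i , a)) c = (target c i a + (Q ∸ sum (removeAt (bladeHats c i) a) % Q)) mod Q

  windmillGuess-local : ∀ v (c c′ : Colouring W Q) → (∀ u → Adj W v u → c u ≡ c′ u) →
    windmillGuess v c ≡ windmillGuess v c′
  windmillGuess-local nothing c c′ agree = cong (_mod Q) (fromDigits-cong λ i →
    cong (λ s → 1 ∸ s % Q / M) (sum-cong-≗ λ b → cong toℕ (agree (just (i , b)) tt)))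
  windmillGuess-local (just (i , a)) c c′ agree =
    cong₂ (λ x r → (toℕ a + digit (toℕ x) i * M + (Q ∸ r % Q)) mod Q)
    (agree nothing tt)
    (sum-cong-≗ λ b → cong toℕ (agree (just (i , punchIn a b)) (refl , punchInᵢ≢i a b ∘ sym)))

  windmillStrategy : Strategy W Q
  windmillStrategy = record { guess = windmillGuess ; local = windmillGuess-local }

  half<2 : ∀ c i → half c i < 2
  half<2 c i = m<n*o⇒m/o<n (m%n<n (sum (bladeHats c i)) Q)

  blade-wins : ∀ c i → half c i ≡ digit (toℕ (c nothing)) i →
    ∃ λ a → windmillGuess (just (i , a)) c ≡ c (just (i , a))
  blade-wins c i half≡digit = a , toℕ-injective (begin
    toℕ ((target c i a + (Q ∸ r % Q)) mod Q)      ≡⟨ toℕ-mod (target c i a + (Q ∸ r % Q)) Q ⟩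
    (target c i a + (Q ∸ r % Q)) % Q              ≡⟨ cong (λ t → (t + (Q ∸ r % Q)) % Q) target≡blade-sum ⟩
    ((bladeHats c i a + r) % Q + (Q ∸ r % Q)) % Q ≡⟨ %-cancel-complement Q r (toℕ<n (c (just (i , a)))) ⟩
    toℕ (c (just (i , a)))                        ∎)
    where
      open ≡-Reasoning
      s : ℕ
      s = sum (bladeHats c i) % Q
      a : Fin M
      a = s mod M
      r : ℕ
      r = sum (removeAt (bladeHats c i) a)
      target≡blade-sum : target c i a ≡ (bladeHats c i a + r) % Q
      target≡blade-sum = begin
        toℕ a + digit (toℕ (c nothing)) i * M  ≡⟨ cong₂ (λ x y → x + y * M) (toℕ-mod s M) (sym half≡digit) ⟩
        s % M + s / M * M                       ≡⟨ m≡m%n+[m/n]*n s M ⟨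
        s                                       ≡⟨ cong (_% Q) (sum-remove (bladeHats c i)) ⟩
        (bladeHats c i a + r) % Q               ∎

  centre-wins : ∀ c → (∀ i → half c i ≢ digit (toℕ (c nothing)) i) → windmillGuess nothing c ≡ c nothing
  centre-wins c blades-lose = toℕ-injective (begin
    toℕ (fromDigits (λ i → 1 ∸ half c i) mod Q)  ≡⟨ toℕ-mod (fromDigits (λ i → 1 ∸ half c i)) Q ⟩
    fromDigits (λ i → 1 ∸ half c i) % Q          ≡⟨ cong (_% Q) (fromDigits-cong digit≡1∸half) ⟨
    fromDigits (digit {n} (toℕ x)) % Q           ≡⟨ cong (_% Q) (fromDigits-digit n (toℕ x) (≤-trans (toℕ<n x) 2[1+m]≤2ⁿ)) ⟩
    toℕ x % Q                                    ≡⟨ m<n⇒m%n≡m (toℕ<n x) ⟩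
    toℕ x                                        ∎)
    where
      open ≡-Reasoning
      x : Fin Q
      x = c nothing
      digit≡1∸half : ∀ i → digit (toℕ x) i ≡ 1 ∸ half c i
      digit≡1∸half i = complement-bit (half<2 c i) (digit<2 (toℕ x) i) (blades-lose i)

  windmillStrategy-wins : Wins windmillStrategy
  windmillStrategy-wins c with any? (λ i → half c i ≟ digit (toℕ (c nothing)) i)
  ... | yes (i , half≡digit) = let a , hit = blade-wins c i half≡digit in just (i , a) , hit
  ... | no  blades-lose      = nothing , centre-wins c (λ i eq → blades-lose (i , eq))

windmill-winning : ∀ m n → 2 * suc m ≤ 2 ^ n → Winning (windmill (suc (suc m)) n) (2 * suc m)
windmill-winning m n 2[1+m]≤2ⁿ = windmillStrategy , windmillStrategy-wins
  where open WindmillStrategy m n 2[1+m]≤2ⁿ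

mainTheorem3 : ∀ (k n : ℕ) → 2 ≤ k → 2 * k ∸ 2 ≤ 2 ^ n →
    IsHatGuessingNumber (windmill k n) (2 * k ∸ 2)
mainTheorem3 (suc (suc m)) n (s≤s (s≤s z≤n)) 2k-2≤2ⁿ rewrite sym (*-distribˡ-∸ 2 (suc (suc m)) 1) =
  windmill-winning m n 2k-2≤2ⁿ ,
  λ q 2k-2<q → windmill-losing (suc m) n q (≤-trans (m≤m*n 2 (suc m)) (<⇒≤ 2k-2<q)) 2k-2<q
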